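{- Let $X$ be a $(95,40,12,20)$ strongly regular graph and let $\{k_1,\ldots,k_5\}$ be the vertex set of a $5$-clique $K_5$ of $X$. For $1\le i<j\le 5$ let $X_{i,j}$ be the set of vertices of $V(X)\setminus V(K_5)$ that are adjacent to both $k_i$ and $k_j$. Let $1\le i<j\le 5$ and $1\le k<l\le 5$ with $\{i,j\}\ne\{k,l\}$, let $T$ be a triangle contained in $X_{i,j}$ and $T'$ a triangle contained in $X_{k,l}$, and let $c=|\{i,j,k,l\}|$. If $c=3$, the edges of $X$ between $V(T)$ and $V(T')$ form a perfect matching between them. If $c=4$, the edges of $X$ between $V(T)$ and $V(T')$ form the complement (in the complete bipartite graph between $V(T)$ and $V(T')$) of a perfect matching.
   Context: A $k$-regular graph $G$ on $v$ vertices is a $(v,k,\lambda,\mu)$ strongly regular graph if any two distinct adjacent vertices have exactly $\lambda$ common neighbours and any two distinct non-adjacent vertices have exactly $\mu$ common neighbours. -}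

module Defs where

open import Data.Nat using (ℕ)
open import Data.Bool using (Bool; true; false; if_then_else_; _∧_; _∨_)
open import Data.Fin using (Fin; _<_)
open import Data.Fin.Properties using (_≟_)
open import Data.List using (List; map; allFin)
open import Data.Nat.ListAction using (sum)
open import Data.Product using (_×_; Σ)
open import Data.Fin.Permutation using (Permutation′; _⟨$⟩ʳ_)
open import Function.Bundles using (_⇔_)
open import Relation.Nullary using (¬_; ⌊_⌋)
open import Relation.Binary.PropositionalEquality using (_≡_; _≢_)

count : {n : ℕ} → (Fin n → Bool) → ℕ
count {n} p = sum (map (λ x → if p x then 1 else 0) (allFin n))

record Graph (n : ℕ) : Set where
  field
    adj   : Fin n → Fin n → Bool
    sym   : ∀ x y → adj x y ≡ adj y x
    irrefl : ∀ x → adj x x ≡ false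
open Graph public

Adj : {n : ℕ} → Graph n → Fin n → Fin n → Set
Adj G x y = adj G x y ≡ true

degree : {n : ℕ} → Graph n → Fin n → ℕ
degree G x = count (λ y → adj G x y)

commonNeighbours : {n : ℕ} → Graph n → Fin n → Fin n → ℕ
commonNeighbours G x y = count (λ z → adj G x z ∧ adj G z y)

IsSRG : {v : ℕ} → Graph v → ℕ → ℕ → ℕ → Set
IsSRG G k l m =
  (∀ x → degree G x ≡ k) ×
  (∀ x y → x ≢ y → Adj G x y → commonNeighbours G x y ≡ l) ×
  (∀ x y → x ≢ y → ¬ Adj G x y → commonNeighbours G x y ≡ m)

IsClique : {n r : ℕ} → Graph n → (Fin r → Fin n) → Set
IsClique G f = (∀ a b → f a ≡ f b → a ≡ b) × (∀ a b → a ≢ b → Adj G (f a) (f b))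

InX : {n : ℕ} → Graph n → (Fin 5 → Fin n) → Fin 5 → Fin 5 → Fin n → Set
InX G K i j x = (∀ a → x ≢ K a) × Adj G x (K i) × Adj G x (K j)

IsTriangleIn : {n : ℕ} → Graph n → (Fin 5 → Fin n) → Fin 5 → Fin 5 → (Fin 3 → Fin n) → Set
IsTriangleIn G K i j T = IsClique G T × (∀ m → InX G K i j (T m))

card4 : Fin 5 → Fin 5 → Fin 5 → Fin 5 → ℕ
card4 i j k l = count (λ x → ⌊ x ≟ i ⌋ ∨ ⌊ x ≟ j ⌋ ∨ ⌊ x ≟ k ⌋ ∨ ⌊ x ≟ l ⌋)

PerfectMatchingBetween : {n : ℕ} → Graph n → (Fin 3 → Fin n) → (Fin 3 → Fin n) → Set
PerfectMatchingBetween G T T' =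
  Σ (Permutation′ 3) λ σ → (∀ m m' → Adj G (T m) (T' m') ⇔ (σ ⟨$⟩ʳ m ≡ m'))

CoPerfectMatchingBetween : {n : ℕ} → Graph n → (Fin 3 → Fin n) → (Fin 3 → Fin n) → Set
CoPerfectMatchingBetween G T T' =
  Σ (Permutation′ 3) λ σ → (∀ m m' → Adj G (T m) (T' m') ⇔ (σ ⟨$⟩ʳ m ≢ m'))

module Submission where

-- Let a y be the number of neighbours of y in the clique K. Counting edges and common
-- neighbours gives ∑ a = 5·40 and ∑ a² = 5·40 + 20·12, hence ∑ (a − 2)² = 440 − 800 + 4·95 = 20.
-- The five clique vertices have a = 4 and already contribute 20, so every vertex outside K has
-- exactly two neighbours in K; in particular a vertex of X_{k,l} sees exactly K k and K l.
-- For a triangle T ⊆ X_{i,j}, the vertices K i, K j and T form another 5-clique, so every vertex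
-- of T′ has two neighbours in it, |{i,j} ∩ {k,l}| of them among K i and K j. This intersection
-- has size 1 when c = 3 and 0 when c = 4, which leaves one, respectively two, neighbours in T;
-- by symmetry the same holds with T and T′ exchanged, and a 0/1 matrix whose row and column
-- sums are all 1 is a permutation matrix.

open import Defs renaming (sym to adj-sym; irrefl to adj-irrefl)
open import Data.Bool.Base using (Bool; true; false; not; _∧_; _∨_; if_then_else_)
open import Data.Bool.Properties using (∧-idem; ¬-not) renaming (_≟_ to _≟ᵇ_)
open import Data.Fin.Base using (Fin; zero; suc; _<_; punchIn; punchOut)
open import Data.Fin.Properties
  using (_≟_; any?; all?; <⇒≢; punchIn-punchOut; punchOut-injective; punchInᵢ≢i)
  renaming (suc-injective to Fin-suc-injective)
open import Data.Fin.Permutation using (Permutation′; _⟨$⟩ʳ_; permutation)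
open import Data.List.Base using (tabulate)
open import Data.List.Properties using (map-tabulate)
import Data.Nat.ListAction as List
open import Data.Nat.Base using (ℕ; zero; suc; _+_; _*_; _^_; _≤_; z≤n; s≤s; ∣_-_∣)
open import Data.Nat.Properties
  using (+-*-semiring; suc-injective; m≤m+n; +-monoʳ-≤; ≤-trans; ≤-reflexive; +-assoc; ≤-refl;
         +-cancelˡ-≡; +-cancelʳ-≡; +-cancelʳ-≤; n≤0⇒n≡0; m^n≡0⇒m≡0; ∣m-n∣≡0⇒m≡n;
         module ≤-Reasoning)
  renaming (_≟_ to _≟ℕ_)
open import Data.Nat.Tactic.RingSolver using (solve-∀)
open import Algebra.Properties.Semiring.Sum +-*-semiring
  using (sum-syntax; sum-cong-≗; sum-remove; sum-replicate-zero;
         ∑-distrib-+; ∑-comm; *-distribˡ-sum; *-distribʳ-sum)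
open import Data.Product using (Σ; ∃; _×_; _,_; proj₁; proj₂)
open import Data.Vec.Functional using (_∷_)
open import Function.Base using (_∘_; id)
open import Function.Bundles using (_⇔_; mk⇔; module Equivalence)
open import Relation.Nullary using (¬_; yes; no; does; ¬?; contradiction)
open import Relation.Nullary.Decidable using (dec-true; dec-false; _→-dec_; from-yes)
open import Relation.Binary.PropositionalEquality
  using (_≡_; _≢_; refl; sym; trans; cong; cong₂; subst; module ≡-Reasoning)

[_] : Bool → ℕ
[ b ] = if b then 1 else 0

∑-≥-point : ∀ {n} (h : Fin n → ℕ) i → h i ≤ ∑[ x < n ] h x
∑-≥-point {suc n} h i = ≤-trans (m≤m+n (h i) _) (≤-reflexive (sym (sum-remove {i = i} h)))

∑-∘-injective-≤ : ∀ {r n} (h : Fin n → ℕ) (K : Fin r → Fin n) →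
                  (∀ a b → K a ≡ K b → a ≡ b) → ∑[ c < r ] h (K c) ≤ ∑[ y < n ] h y
∑-∘-injective-≤ {zero}          h K K-inj = z≤n
∑-∘-injective-≤ {suc r} {zero}  h K K-inj with K zero
... | ()
∑-∘-injective-≤ {suc r} {suc n} h K K-inj = begin
  h (K zero) + ∑[ c < r ] h (K (suc c))
    ≡⟨ cong (h (K zero) +_) (sum-cong-≗ (λ c → cong h (sym (punchIn-punchOut (K₀≢K c))))) ⟩
  h (K zero) + ∑[ c < r ] h (punchIn (K zero) (K′ c))
    ≤⟨ +-monoʳ-≤ (h (K zero)) (∑-∘-injective-≤ (h ∘ punchIn (K zero)) K′ K′-inj) ⟩
  h (K zero) + ∑[ y < n ] h (punchIn (K zero) y)
    ≡⟨ sym (sum-remove {i = K zero} h) ⟩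
  ∑[ y < suc n ] h y ∎
  where
  open ≤-Reasoning
  K₀≢K : ∀ c → K zero ≢ K (suc c)
  K₀≢K c e with () ← K-inj zero (suc c) e
  K′ : Fin r → Fin n
  K′ c = punchOut (K₀≢K c)
  K′-inj : ∀ a b → K′ a ≡ K′ b → a ≡ b
  K′-inj a b e = Fin-suc-injective (K-inj (suc a) (suc b) (punchOut-injective (K₀≢K a) (K₀≢K b) e))

listSum-tabulate : ∀ {n} (f : Fin n → ℕ) → List.sum (tabulate f) ≡ ∑[ x < n ] f x
listSum-tabulate {zero}  f = refl
listSum-tabulate {suc n} f = cong (f zero +_) (listSum-tabulate (λ x → f (suc x)))

count≡∑ : ∀ {n} (p : Fin n → Bool) → count p ≡ ∑[ x < n ] [ p x ]
count≡∑ p = trans (cong List.sum (map-tabulate id (λ x → [ p x ]))) (listSum-tabulate (λ x → [ p x ]))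

count-cong : ∀ {n} {p q : Fin n → Bool} → (∀ x → p x ≡ q x) → count p ≡ count q
count-cong {n} {p} {q} p≗q = begin
  count p              ≡⟨ count≡∑ p ⟩
  ∑[ x < n ] [ p x ]   ≡⟨ sum-cong-≗ (cong [_] ∘ p≗q) ⟩
  ∑[ x < n ] [ q x ]   ≡⟨ count≡∑ q ⟨
  count q              ∎
  where open ≡-Reasoning

count-none : ∀ {n} {p : Fin n → Bool} → (∀ x → p x ≡ false) → count p ≡ 0
count-none {n} {p} none = trans (count≡∑ p) (trans (sum-cong-≗ (cong [_] ∘ none)) (sum-replicate-zero n))

count≡0⇒false : ∀ {n} {p : Fin n → Bool} → count p ≡ 0 → ∀ x → p x ≡ false
count≡0⇒false {p = p} count≡0 x with p x in px | ∑-≥-point (λ y → [ p y ]) x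
... | false | _ = refl
... | true  | 1≤∑ with () ← ≤-trans 1≤∑ (≤-reflexive (trans (sym (count≡∑ p)) count≡0))

count-not : ∀ {n} (p : Fin n → Bool) → count p + count (not ∘ p) ≡ n
count-not {n} p = begin
  count p + count (not ∘ p)
    ≡⟨ cong₂ _+_ (count≡∑ p) (count≡∑ (not ∘ p)) ⟩
  ∑[ x < n ] [ p x ] + ∑[ x < n ] [ not (p x) ]
    ≡⟨ ∑-distrib-+ (λ x → [ p x ]) (λ x → [ not (p x) ]) ⟨
  ∑[ x < n ] ([ p x ] + [ not (p x) ])
    ≡⟨ sum-cong-≗ (λ x → [b]+[not-b]≡1 (p x)) ⟩
  ∑[ x < n ] 1
    ≡⟨ ∑-const-1 n ⟩
  n ∎
  where
  open ≡-Reasoning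
  [b]+[not-b]≡1 : ∀ b → [ b ] + [ not b ] ≡ 1
  [b]+[not-b]≡1 true  = refl
  [b]+[not-b]≡1 false = refl
  ∑-const-1 : ∀ m → ∑[ x < m ] 1 ≡ m
  ∑-const-1 zero    = refl
  ∑-const-1 (suc m) = cong suc (∑-const-1 m)

count-*-count : ∀ {m n} (p : Fin m → Bool) (q : Fin n → Bool) →
                count p * count q ≡ ∑[ x < m ] ∑[ y < n ] [ p x ∧ q y ]
count-*-count {m} {n} p q = begin
  count p * count q
    ≡⟨ cong₂ _*_ (count≡∑ p) (count≡∑ q) ⟩
  (∑[ x < m ] [ p x ]) * (∑[ y < n ] [ q y ])
    ≡⟨ *-distribʳ-sum _ (λ x → [ p x ]) ⟩
  ∑[ x < m ] ([ p x ] * ∑[ y < n ] [ q y ])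
    ≡⟨ sum-cong-≗ (λ x → *-distribˡ-sum [ p x ] (λ y → [ q y ])) ⟩
  ∑[ x < m ] ∑[ y < n ] ([ p x ] * [ q y ])
    ≡⟨ sum-cong-≗ (λ x → sum-cong-≗ (λ y → [a]*[b]≡[a∧b] (p x) (q y))) ⟩
  ∑[ x < m ] ∑[ y < n ] [ p x ∧ q y ] ∎
  where
  open ≡-Reasoning
  [a]*[b]≡[a∧b] : ∀ a b → [ a ] * [ b ] ≡ [ a ∧ b ]
  [a]*[b]≡[a∧b] true  true  = refl
  [a]*[b]≡[a∧b] true  false = refl
  [a]*[b]≡[a∧b] false b     = refl

count≡1⇒∃ : ∀ {n} {p : Fin n → Bool} → count p ≡ 1 → ∃ λ x → p x ≡ true
count≡1⇒∃ {p = p} count≡1 with any? (λ x → p x ≟ᵇ true)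
... | yes witness = witness
... | no  none with () ← trans (sym count≡1) (count-none (λ x → ¬-not (λ px → none (x , px))))

count-remove : ∀ {n} (p : Fin (suc n) → Bool) {i} → p i ≡ true →
               count p ≡ suc (count (p ∘ punchIn i))
count-remove {n} p {i} pi≡true = begin
  count p
    ≡⟨ count≡∑ p ⟩
  ∑[ x < suc n ] [ p x ]
    ≡⟨ sum-remove {i = i} (λ x → [ p x ]) ⟩
  [ p i ] + ∑[ x < n ] [ p (punchIn i x) ]
    ≡⟨ cong (λ b → [ b ] + ∑[ x < n ] [ p (punchIn i x) ]) pi≡true ⟩
  suc (∑[ x < n ] [ p (punchIn i x) ])
    ≡⟨ cong suc (count≡∑ (p ∘ punchIn i)) ⟨
  suc (count (p ∘ punchIn i)) ∎
  where open ≡-Reasoning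

count≡1⇒≡ : ∀ {n} {p : Fin n → Bool} → count p ≡ 1 →
            ∀ {x y} → p x ≡ true → p y ≡ true → x ≡ y
count≡1⇒≡ {suc n} {p} count≡1 {x} {y} px py with x ≟ y
... | yes x≡y = x≡y
... | no  x≢y = contradiction (trans (sym py) py≡false) λ ()
  where
  py≡false : p y ≡ false
  py≡false = subst (λ z → p z ≡ false) (punchIn-punchOut x≢y)
               (count≡0⇒false (suc-injective (trans (sym (count-remove p px)) count≡1)) (punchOut x≢y))

count≡2⇒≡ : ∀ {n} {p : Fin n → Bool} → count p ≡ 2 →
            ∀ {i x y} → p i ≡ true → i ≢ x → i ≢ y → p x ≡ true → p y ≡ true → x ≡ y
count≡2⇒≡ {suc n} {p} count≡2 {i} pi i≢x i≢y px py =
  punchOut-injective i≢x i≢y (count≡1⇒≡ (suc-injective (trans (sym (count-remove p pi)) count≡2))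
    (trans (cong p (punchIn-punchOut i≢x)) px) (trans (cong p (punchIn-punchOut i≢y)) py))

count-≢ : ∀ {n} (c : Fin (suc n)) → count (λ x → not (does (x ≟ c))) ≡ n
count-≢ {n} c = suc-injective (begin
  suc (count (not ∘ is-c))                  ≡⟨ cong (_+ count (not ∘ is-c)) count-is-c ⟨
  count is-c + count (not ∘ is-c)           ≡⟨ count-not is-c ⟩
  suc n                                     ∎)
  where
  open ≡-Reasoning
  is-c : Fin (suc n) → Bool
  is-c x = does (x ≟ c)
  count-is-c : count is-c ≡ 1
  count-is-c = trans (count-remove is-c {c} (dec-true (c ≟ c) refl))
                     (cong suc (count-none {n} (λ x → dec-false (punchIn c x ≟ c) (punchInᵢ≢i c x))))

permutation-matrix : ∀ {n} (P : Fin n → Fin n → Bool) →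
                     (∀ r → count (P r) ≡ 1) → (∀ c → count (λ r → P r c) ≡ 1) →
                     Σ (Permutation′ n) λ σ → ∀ r c → P r c ≡ true ⇔ σ ⟨$⟩ʳ r ≡ c
permutation-matrix {n} P row col = σ , λ r c → mk⇔ (count≡1⇒≡ (row r) (in-row r)) λ { refl → in-row r }
  where
  to from : Fin n → Fin n
  to   r = proj₁ (count≡1⇒∃ {p = P r} (row r))
  from c = proj₁ (count≡1⇒∃ {p = λ r → P r c} (col c))
  in-row : ∀ r → P r (to r) ≡ true
  in-row r = proj₂ (count≡1⇒∃ {p = P r} (row r))
  in-col : ∀ c → P (from c) c ≡ true
  in-col c = proj₂ (count≡1⇒∃ {p = λ r → P r c} (col c))
  σ : Permutation′ n
  σ = permutation to from (λ c → count≡1⇒≡ (row (from c)) (in-row (from c)) (in-col c))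
                          (λ r → count≡1⇒≡ (col (to r)) (in-col (to r)) (in-row r))

not-true⇔⇒true⇔¬ : ∀ {b} {Q : Set} → (not b ≡ true ⇔ Q) → (b ≡ true ⇔ (¬ Q))
not-true⇔⇒true⇔¬ {true}  iff = mk⇔ (λ _ q → contradiction (Equivalence.from iff q) λ ()) (λ _ → refl)
not-true⇔⇒true⇔¬ {false} iff = mk⇔ (λ ()) (λ ¬q → contradiction (Equivalence.to iff refl) ¬q)

module _ {n : ℕ} (X : Graph n) where

  ¬Adj-refl : ∀ x → ¬ Adj X x x
  ¬Adj-refl x e with () ← trans (sym e) (adj-irrefl X x)

  Adj-sym : ∀ {x y} → Adj X x y → Adj X y x
  Adj-sym {x} {y} = trans (adj-sym X y x)

  adjacent⇒injective : ∀ {r} (f : Fin r → Fin n) → (∀ a b → a ≢ b → Adj X (f a) (f b)) →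
                       ∀ a b → f a ≡ f b → a ≡ b
  adjacent⇒injective f adjacent a b fa≡fb with a ≟ b
  ... | yes a≡b = a≡b
  ... | no  a≢b = contradiction (subst (λ z → Adj X z (f b)) fa≡fb (adjacent a b a≢b)) (¬Adj-refl (f b))

  commonNeighbours-self : ∀ x → commonNeighbours X x x ≡ degree X x
  commonNeighbours-self x = count-cong (λ z → trans (cong (adj X x z ∧_) (adj-sym X z x)) (∧-idem (adj X x z)))

  neighboursIn : ∀ {r} → (Fin r → Fin n) → Fin n → ℕ
  neighboursIn K y = count (λ c → adj X (K c) y)

  module _ {r : ℕ} (K : Fin r → Fin n) where

    ∑-neighboursIn : ∑[ y < n ] neighboursIn K y ≡ ∑[ c < r ] degree X (K c)
    ∑-neighboursIn = begin
      ∑[ y < n ] neighboursIn K y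
        ≡⟨ sum-cong-≗ (λ y → count≡∑ (λ c → adj X (K c) y)) ⟩
      ∑[ y < n ] ∑[ c < r ] [ adj X (K c) y ]
        ≡⟨ ∑-comm (λ y c → [ adj X (K c) y ]) ⟩
      ∑[ c < r ] ∑[ y < n ] [ adj X (K c) y ]
        ≡⟨ sum-cong-≗ (λ c → count≡∑ (adj X (K c))) ⟨
      ∑[ c < r ] degree X (K c) ∎
      where open ≡-Reasoning

    ∑-neighboursIn² : ∑[ y < n ] (neighboursIn K y * neighboursIn K y) ≡
                      ∑[ c < r ] ∑[ d < r ] commonNeighbours X (K c) (K d)
    ∑-neighboursIn² = begin
      ∑[ y < n ] (neighboursIn K y * neighboursIn K y)
        ≡⟨ sum-cong-≗ (λ y → count-*-count (λ c → adj X (K c) y) (λ d → adj X (K d) y)) ⟩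
      ∑[ y < n ] ∑[ c < r ] ∑[ d < r ] [ adj X (K c) y ∧ adj X (K d) y ]
        ≡⟨ ∑-comm (λ y c → ∑[ d < r ] [ adj X (K c) y ∧ adj X (K d) y ]) ⟩
      ∑[ c < r ] ∑[ y < n ] ∑[ d < r ] [ adj X (K c) y ∧ adj X (K d) y ]
        ≡⟨ sum-cong-≗ (λ c → ∑-comm (λ y d → [ adj X (K c) y ∧ adj X (K d) y ])) ⟩
      ∑[ c < r ] ∑[ d < r ] ∑[ y < n ] [ adj X (K c) y ∧ adj X (K d) y ]
        ≡⟨ sum-cong-≗ (λ c → sum-cong-≗ (λ d → sum-cong-≗ (λ y →
             cong (λ b → [ adj X (K c) y ∧ b ]) (adj-sym X (K d) y)))) ⟩
      ∑[ c < r ] ∑[ d < r ] ∑[ y < n ] [ adj X (K c) y ∧ adj X y (K d) ]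
        ≡⟨ sum-cong-≗ (λ c → sum-cong-≗ (λ d →
             count≡∑ (λ y → adj X (K c) y ∧ adj X y (K d)))) ⟨
      ∑[ c < r ] ∑[ d < r ] commonNeighbours X (K c) (K d) ∎
      where open ≡-Reasoning

  neighboursIn-clique : ∀ {r} {K : Fin (suc r) → Fin n} → IsClique X K → ∀ c → neighboursIn K (K c) ≡ r
  neighboursIn-clique {K = K} (_ , K-adj) c = trans (count-cong adj-K) (count-≢ c)
    where
    adj-K : ∀ d → adj X (K d) (K c) ≡ not (does (d ≟ c))
    adj-K d with d ≟ c
    ... | yes refl = adj-irrefl X (K c)
    ... | no  d≢c  = K-adj d c d≢c

inPair : Fin 5 → Fin 5 → Fin 5 → Bool
inPair k l c = does (c ≟ k) ∨ does (c ≟ l)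

shared : Fin 5 → Fin 5 → Fin 5 → Fin 5 → ℕ
shared i j k l = [ inPair k l i ] + [ inPair k l j ]

-- Inclusion–exclusion for {i,j} ∪ {k,l}, checked on all 5⁴ index tuples.
card4+shared≡4 : ∀ i j k l → i ≢ j → k ≢ l → card4 i j k l + shared i j k l ≡ 4
card4+shared≡4 = from-yes (all? λ i → all? λ j → all? λ k → all? λ l →
  ¬? (i ≟ j) →-dec ¬? (k ≟ l) →-dec card4 i j k l + shared i j k l ≟ℕ 4)

shared-comm : ∀ i j k l → i ≢ j → k ≢ l → shared i j k l ≡ shared k l i j
shared-comm = from-yes (all? λ i → all? λ j → all? λ k → all? λ l →
  ¬? (i ≟ j) →-dec ¬? (k ≟ l) →-dec shared i j k l ≟ℕ shared k l i j)

module _ {n : ℕ} (X : Graph n) {K : Fin 5 → Fin n} (clique : IsClique X K) where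

  triangle-extends-clique : ∀ {i j T} → i ≢ j → IsTriangleIn X K i j T → IsClique X (K i ∷ K j ∷ T)
  triangle-extends-clique {i} {j} {T} i≢j ((_ , T-adj) , T⊆X) =
    adjacent⇒injective X (K i ∷ K j ∷ T) K∷T-adj , K∷T-adj
    where
    K∷T-adj : ∀ a b → a ≢ b → Adj X ((K i ∷ K j ∷ T) a) ((K i ∷ K j ∷ T) b)
    K∷T-adj zero          zero          a≢b = contradiction refl a≢b
    K∷T-adj zero          (suc zero)    _   = proj₂ clique i j i≢j
    K∷T-adj zero          (suc (suc m)) _   = Adj-sym X (proj₁ (proj₂ (T⊆X m)))
    K∷T-adj (suc zero)    zero          _   = proj₂ clique j i (i≢j ∘ sym)
    K∷T-adj (suc zero)    (suc zero)    a≢b = contradiction refl a≢b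
    K∷T-adj (suc zero)    (suc (suc m)) _   = Adj-sym X (proj₂ (proj₂ (T⊆X m)))
    K∷T-adj (suc (suc m)) zero          _   = proj₁ (proj₂ (T⊆X m))
    K∷T-adj (suc (suc m)) (suc zero)    _   = proj₂ (proj₂ (T⊆X m))
    K∷T-adj (suc (suc m)) (suc (suc m′)) a≢b = T-adj m m′ (a≢b ∘ cong (λ x → suc (suc x)))

∣2-m∣²+4m≡m²+4 : ∀ m → ∣ 2 - m ∣ ^ 2 + 4 * m ≡ m * m + 4
∣2-m∣²+4m≡m²+4 0             = refl
∣2-m∣²+4m≡m²+4 1             = refl
∣2-m∣²+4m≡m²+4 (suc (suc m)) = expand m
  where
  expand : ∀ m → m * (m * 1) + 4 * (2 + m) ≡ (2 + m) * (2 + m) + 4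
  expand = solve-∀

module _ (X : Graph 95) (srg : IsSRG X 40 12 20) where

  private
    dist² : ℕ → ℕ
    dist² m = ∣ 2 - m ∣ ^ 2

  module _ {K : Fin 5 → Fin 95} (clique : IsClique X K) where

    private
      a : Fin 95 → ℕ
      a = neighboursIn X K

    ∑-neighboursIn≡200 : ∑[ y < 95 ] a y ≡ 200
    ∑-neighboursIn≡200 = trans (∑-neighboursIn X K) (sum-cong-≗ (λ c → proj₁ srg (K c)))

    ∑-neighboursIn²≡440 : ∑[ y < 95 ] (a y * a y) ≡ 440
    ∑-neighboursIn²≡440 =
      trans (∑-neighboursIn² X K) (sum-cong-≗ (λ c → sum-cong-≗ (commonNeighbours-K c)))
      where
      commonNeighbours-K : ∀ c d → commonNeighbours X (K c) (K d) ≡ (if does (c ≟ d) then 40 else 12)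
      commonNeighbours-K c d with c ≟ d
      ... | yes refl = trans (commonNeighbours-self X (K c)) (proj₁ srg (K c))
      ... | no  c≢d  = proj₁ (proj₂ srg) (K c) (K d) (c≢d ∘ proj₁ clique c d) (proj₂ clique c d c≢d)

    ∑-dist²≡20 : ∑[ y < 95 ] dist² (a y) ≡ 20
    ∑-dist²≡20 = +-cancelʳ-≡ 800 _ _ (begin
      ∑[ y < 95 ] dist² (a y) + 800
        ≡⟨ cong (λ s → ∑[ y < 95 ] dist² (a y) + 4 * s) ∑-neighboursIn≡200 ⟨
      ∑[ y < 95 ] dist² (a y) + 4 * ∑[ y < 95 ] a y
        ≡⟨ cong (∑[ y < 95 ] dist² (a y) +_) (*-distribˡ-sum 4 a) ⟩
      ∑[ y < 95 ] dist² (a y) + ∑[ y < 95 ] (4 * a y)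
        ≡⟨ ∑-distrib-+ (dist² ∘ a) (λ y → 4 * a y) ⟨
      ∑[ y < 95 ] (dist² (a y) + 4 * a y)
        ≡⟨ sum-cong-≗ (∣2-m∣²+4m≡m²+4 ∘ a) ⟩
      ∑[ y < 95 ] (a y * a y + 4)
        ≡⟨ ∑-distrib-+ (λ y → a y * a y) (λ _ → 4) ⟩
      ∑[ y < 95 ] (a y * a y) + ∑[ y < 95 ] 4
        ≡⟨ cong (_+ ∑[ y < 95 ] 4) ∑-neighboursIn²≡440 ⟩
      820 ∎)
      where open ≡-Reasoning

    outside⇒neighboursIn≡2 : ∀ y → (∀ c → y ≢ K c) → a y ≡ 2
    outside⇒neighboursIn≡2 y y∉K = sym (∣m-n∣≡0⇒m≡n (m^n≡0⇒m≡0 _ 2 (n≤0⇒n≡0 dist²≤0)))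
      where
      y∷K-injective : ∀ c d → (y ∷ K) c ≡ (y ∷ K) d → c ≡ d
      y∷K-injective zero    zero    _ = refl
      y∷K-injective zero    (suc d) e = contradiction e (y∉K d)
      y∷K-injective (suc c) zero    e = contradiction (sym e) (y∉K c)
      y∷K-injective (suc c) (suc d) e = cong suc (proj₁ clique c d e)
      dist²≤0 : dist² (a y) ≤ 0
      dist²≤0 = +-cancelʳ-≤ 20 _ 0 (begin
        dist² (a y) + 20
          ≡⟨ cong (dist² (a y) +_) (sum-cong-≗ (cong dist² ∘ neighboursIn-clique X clique)) ⟨
        dist² (a y) + ∑[ c < 5 ] dist² (a (K c))
          ≤⟨ ∑-∘-injective-≤ (dist² ∘ a) (y ∷ K) y∷K-injective ⟩
        ∑[ x < 95 ] dist² (a x)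
          ≡⟨ ∑-dist²≡20 ⟩
        20 ∎)
        where open ≤-Reasoning

    InX⇒adj≡inPair : ∀ {k l y} → k ≢ l → InX X K k l y → ∀ c → adj X (K c) y ≡ inPair k l c
    InX⇒adj≡inPair {k} {l} {y} k≢l (y∉K , y~Kk , y~Kl) c with c ≟ k
    ... | yes refl = Adj-sym X y~Kk
    ... | no  c≢k with c ≟ l
    ...   | yes refl = Adj-sym X y~Kl
    ...   | no  c≢l with adj X (K c) y in Kc~y
    ...     | false = refl
    ...     | true  = contradiction (count≡2⇒≡ (outside⇒neighboursIn≡2 y y∉K) {i = k}
                                       (Adj-sym X y~Kk) k≢l (c≢k ∘ sym) (Adj-sym X y~Kl) Kc~y)
                                    (c≢l ∘ sym)

  triangle-cross-count : ∀ {K i j k l T T′} → IsClique X K → i ≢ j → k ≢ l →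
                         IsTriangleIn X K i j T → IsTriangleIn X K k l T′ → shared i j k l ≤ 1 →
                         ∀ m′ → shared i j k l + count (λ m → adj X (T m) (T′ m′)) ≡ 2
  triangle-cross-count {K} {i} {j} {k} {l} {T} {T′} clique i≢j k≢l T-tri T′-tri shared≤1 m′ = begin
    shared i j k l + count (λ m → adj X (T m) y)
      ≡⟨ cong₂ (λ p q → [ p ] + [ q ] + count (λ m → adj X (T m) y)) (profile i) (profile j) ⟨
    [ adj X (K i) y ] + [ adj X (K j) y ] + count (λ m → adj X (T m) y)
      ≡⟨ +-assoc [ adj X (K i) y ] [ adj X (K j) y ] _ ⟩
    [ adj X (K i) y ] + ([ adj X (K j) y ] + count (λ m → adj X (T m) y))
      ≡⟨ cong (λ s → [ adj X (K i) y ] + ([ adj X (K j) y ] + s)) (count≡∑ (λ m → adj X (T m) y)) ⟩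
    ∑[ c < 5 ] [ adj X ((K i ∷ K j ∷ T) c) y ]
      ≡⟨ count≡∑ (λ c → adj X ((K i ∷ K j ∷ T) c) y) ⟨
    neighboursIn X (K i ∷ K j ∷ T) y
      ≡⟨ outside⇒neighboursIn≡2 (triangle-extends-clique X clique i≢j T-tri) y y∉K∷T ⟩
    2 ∎
    where
    open ≡-Reasoning
    y : Fin 95
    y = T′ m′
    profile : ∀ c → adj X (K c) y ≡ inPair k l c
    profile = InX⇒adj≡inPair clique k≢l (proj₂ T′-tri m′)
    y∉K∷T : ∀ c → y ≢ (K i ∷ K j ∷ T) c
    y∉K∷T zero          = proj₁ (proj₂ T′-tri m′) i
    y∉K∷T (suc zero)    = proj₁ (proj₂ T′-tri m′) j
    y∉K∷T (suc (suc m)) y≡Tm = contradiction (subst (_≤ 1) shared≡2 shared≤1) λ { (s≤s ()) }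
      where
      in-pair : ∀ {c} → Adj X (T m) (K c) → inPair k l c ≡ true
      in-pair {c} Tm~Kc = trans (sym (profile c)) (Adj-sym X (subst (λ z → Adj X z (K c)) (sym y≡Tm) Tm~Kc))
      shared≡2 : shared i j k l ≡ 2
      shared≡2 = cong₂ (λ p q → [ p ] + [ q ]) (in-pair (proj₁ (proj₂ (proj₂ T-tri m))))
                                                (in-pair (proj₂ (proj₂ (proj₂ T-tri m))))

lemma22 : (X : Graph 95) → IsSRG X 40 12 20 →
          (K : Fin 5 → Fin 95) → IsClique X K →
          (i j k l : Fin 5) → i < j → k < l → ¬ (i ≡ k × j ≡ l) →
          (T T' : Fin 3 → Fin 95) → IsTriangleIn X K i j T → IsTriangleIn X K k l T' →
          (card4 i j k l ≡ 3 → PerfectMatchingBetween X T T') ×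
          (card4 i j k l ≡ 4 → CoPerfectMatchingBetween X T T')
lemma22 X srg K clique i j k l i<j k<l _ T T′ T-tri T′-tri = perfect , coPerfect
  where
  i≢j = <⇒≢ i<j
  k≢l = <⇒≢ k<l
  A : Fin 3 → Fin 3 → Bool
  A m m′ = adj X (T m) (T′ m′)
  card4+shared : ∀ {c} → card4 i j k l ≡ c → c + shared i j k l ≡ 4
  card4+shared refl = card4+shared≡4 i j k l i≢j k≢l
  line-sums : ∀ {s} → shared i j k l ≡ s → s ≤ 1 →
              (∀ m → s + count (A m) ≡ 2) × (∀ m′ → s + count (λ m → A m m′) ≡ 2)
  line-sums refl s≤1 =
    (λ m → trans (cong₂ _+_ shared-sym (count-cong (λ m′ → adj-sym X (T m) (T′ m′))))
                 (triangle-cross-count X srg clique k≢l i≢j T′-tri T-tri (subst (_≤ 1) shared-sym s≤1) m)) ,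
    triangle-cross-count X srg clique i≢j k≢l T-tri T′-tri s≤1
    where
    shared-sym = shared-comm i j k l i≢j k≢l
  complement : ∀ {p : Fin 3 → Bool} → count p ≡ 2 → count (not ∘ p) ≡ 1
  complement {p} count≡2 = +-cancelˡ-≡ 2 _ 1 (trans (cong (_+ count (not ∘ p)) (sym count≡2)) (count-not p))
  perfect : card4 i j k l ≡ 3 → PerfectMatchingBetween X T T′
  perfect c≡3 =
    let rows , cols = line-sums (+-cancelˡ-≡ 3 _ 1 (card4+shared c≡3)) ≤-refl
    in  permutation-matrix A (suc-injective ∘ rows) (suc-injective ∘ cols)
  coPerfect : card4 i j k l ≡ 4 → CoPerfectMatchingBetween X T T′
  coPerfect c≡4 =
    let rows , cols  = line-sums (+-cancelˡ-≡ 4 _ 0 (card4+shared c≡4)) z≤n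
        σ , σ-spec   = permutation-matrix (λ m m′ → not (A m m′))
                         (λ m → complement {A m} (rows m)) (λ m′ → complement {λ m → A m m′} (cols m′))
    in  σ , λ m m′ → not-true⇔⇒true⇔¬ (σ-spec m m′)
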